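{- Let $B=(G,\mathbf{i},V_+,V_0,V_-,\rho,X)$ be a symmetric labeled bigraph with dual $B^*=(G^*,\mathbf{i}^*,U_+,U_0,U_-,\rho^*,X^*)$, and assume that both $G$ and $G^*$ are recurrent (i.e. their adjacency matrices of the two color classes commute). Then for a positive integer $N$: $\mathfrak{t}^\rho_v(t+2N)=\mathfrak{t}^\rho_v(t)$ for all $v\in V$ (and all $t$ with $t+\epsilon_v$ even) if and only if $\mathfrak{t}^{\rho^*}_u(t+2N)=\mathfrak{t}^{\rho^*}_u(t)$ for all $u\in U$ (and all $t$ with $t+\epsilon_u$ even), where $\mathfrak{t}^\rho$ is the tropical $T$-system of $G$ and $\mathfrak{t}^{\rho^*}$ that of $G^*$.
   Context: A bigraph $G=(\Gamma,\Delta)$ is a pair of simple graphs on a common vertex set $V$ sharing no edges; bipartite if some $\epsilon:V\to\{0,1\}$ properly 2-colors both; it is recurrent if $A_\Gamma A_\Delta=A_\Delta A_\Gamma$. Tropical $T$-system of a bipartite bigraph with initial $\lambda:V\to\mathbb{R}$: $\mathfrak{t}^\lambda_v(t)$ for $t+\epsilon_v$ even, $\mathfrak{t}^\lambda_v(\epsilon_v)=\lambda(v)$, $\mathfrak{t}^\lambda_v(t+1)+\mathfrak{t}^\lambda_v(t-1)=\max\left(\sum_{\{u,v\}\in\Gamma}\mathfrak{t}^\lambda_u(t),\sum_{\{v,w\}\in\Delta}\mathfrak{t}^\lambda_w(t)\right)$. A symmetric labeled bigraph $B=(G,\mathbf{i},V_+,V_0,V_-,\rho,X)$: a bipartite bigraph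 $G$ on $V$; an order-2 automorphism $\mathbf{i}$ of $G$ preserving $\epsilon$, $\Gamma$ and $\Delta$; $V_0$ its fixed-point set; a partition $V=V_+\sqcup V_0\sqcup V_-$ such that non-fixed pairs $\{v,\mathbf{i}(v)\}$ have one element in each of $V_+,V_-$; $\rho:V\to\mathbb{R}$ with $\rho\circ\mathbf{i}=\rho$; $X$ a set of edges with both endpoints in $V_0$. Write $V_\pm=\{v_1^\pm,\dots,v_k^\pm\}$, $\mathbf{i}(v_j^+)=v_j^-$, $V_0=\{v_{k+1},\dots,v_n\}$. Dual $B^*$: vertices $U_0=\{u_1,\dots,u_k\}$, $U_\pm=\{u_{k+1}^\pm,\dots,u_n^\pm\}$ with colors inherited from corresponding vertices; $\mathbf{i}^*$ fixes $u_j$, swaps $u_j^\pm$; $\rho^*(u_j)=\sqrt2\rho(v_j^\pm)$, $\rho^*(u_j^\pm)=\rho(v_j)/\sqrt2$; $\Gamma^*$, $X^*\cap\Gamma^*$ by: $\{v_i,v_j\}\in\Gamma\cap X$ iff $\{u_i^+,u_j^-\},\{u_i^-,u_j^+\}\in\Gamma^*$; $\{v_i,v_j\}\in\Gamma\setminus X$ iff $\{u_i^+,u_j^+\},\{u_i^-,u_j^-\}\in\Gamma^*$; $\{v_i^\pm,v_j\}\in\Gamma$ iff $\{u_i^\pm,u_j\}\in\Gamma^*$ (both signs); $\{v_i^+,v_j^+\},\{v_i^-,v_j^-\}\in\Gamma$ iff $\{u_i,u_j\}\in\Gamma^*\setminus X^*$; $\{v_i^+,v_j^-\},\{v_i^-,v_j^+\}\in\Gamma$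 iff $\{u_i,u_j\}\in\Gamma^*\cap X^*$; same rules for $\Delta^*$. -}

module Defs where

open import Level using (0ℓ)
open import Data.Bool using (Bool; true; false; _∧_; not; if_then_else_)
open import Data.Nat as ℕ using (ℕ)
open import Data.Fin using (Fin)
open import Data.List using (List; map; _++_; foldr; allFin)
open import Data.Integer as ℤ using (ℤ; +_)
open import Data.Product using (_×_; ∃; ∃-syntax; _,_)
open import Data.Sum using (_⊎_; inj₁; inj₂)
open import Relation.Binary.PropositionalEquality using (_≡_; _≢_)
open import Algebra.Structures using (IsCommutativeRing)
open import Relation.Binary.Structures using (IsTotalOrder)
open import Function.Bundles using (_⇔_)

-- The real numbers, axiomatised as a (Dedekind-)complete ordered field.
-- Any two models are isomorphic, so quantifying over all models is the
-- faithful rendering of "ℝ" (agda-stdlib has no real numbers).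

record RealField : Set₁ where
  infixl 6 _+_
  infixl 7 _*_
  infix 4 _≤_
  field
    Carrier : Set
    _+_ _*_ : Carrier → Carrier → Carrier
    -_      : Carrier → Carrier
    0# 1#   : Carrier
    _≤_     : Carrier → Carrier → Set
    isCommutativeRing : IsCommutativeRing _≡_ _+_ _*_ -_ 0# 1#
    isTotalOrder      : IsTotalOrder _≡_ _≤_
    0≢1     : 0# ≢ 1#
    inverse : ∀ x → x ≢ 0# → ∃[ y ] (x * y ≡ 1#)
    +-mono  : ∀ {x y} z → x ≤ y → x + z ≤ y + z
    *-pos   : ∀ {x y} → 0# ≤ x → 0# ≤ y → 0# ≤ x * y
    complete : (P : Carrier → Set) → ∃ P → (∃[ b ] (∀ x → P x → x ≤ b)) →
               ∃[ s ] ((∀ x → P x → x ≤ s) ×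
                       (∀ b → (∀ x → P x → x ≤ b) → s ≤ b))

  total : ∀ x y → x ≤ y ⊎ y ≤ x
  total = IsTotalOrder.total isTotalOrder

  max : Carrier → Carrier → Carrier
  max x y with total x y
  ... | inj₁ _ = y
  ... | inj₂ _ = x

  _<_ : Carrier → Carrier → Set
  x < y = x ≤ y × x ≢ y

  sumR : List Carrier → Carrier
  sumR = foldr _+_ 0#

IsSqrt2 : (R : RealField) → RealField.Carrier R → Set
IsSqrt2 R s = (0# < s) × (s * s ≡ 1# + 1#)
  where open RealField R

-- Vertex sets of symmetric labeled bigraphs.
-- V = V₊ ⊔ V₋ ⊔ V₀ with V₊ = {v₁⁺..v_k⁺}, V₋ = {v₁⁻..v_k⁻} and
-- V₀ = {v_{k+1}..v_n} (indexed here by Fin m, m = n - k).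

data SV (k m : ℕ) : Set where
  plus  : Fin k → SV k m
  minus : Fin k → SV k m
  zero  : Fin m → SV k m

ι : ∀ {k m} → SV k m → SV k m
ι (plus i)  = minus i
ι (minus i) = plus i
ι (zero j)  = zero j

vertices : ∀ k m → List (SV k m)
vertices k m = map plus (allFin k) ++ map minus (allFin k) ++ map zero (allFin m)

sumℕ : List ℕ → ℕ
sumℕ = foldr ℕ._+_ 0

toℕ : Bool → ℕ
toℕ b = if b then 1 else 0

toℤ : Bool → ℤ
toℤ b = if b then + 1 else + 0

Even Odd : ℤ → Set
Even z = ∃[ q ] (z ≡ q ℤ.+ q)
Odd  z = ∃[ q ] (z ≡ + 1 ℤ.+ (q ℤ.+ q))

-- Symmetric labeled bigraph B = (G, 𝐢, V₊, V₀, V₋, ρ, X).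
-- Γ, Δ are given by Boolean adjacency relations; X is a set of edges
-- (unordered pairs) on V₀, given as a symmetric irreflexive relation.

record SLB (R : RealField) (k m : ℕ) : Set where
  open RealField R using (Carrier)
  field
    Γ Δ   : SV k m → SV k m → Bool
    ε     : SV k m → Bool
    ρ     : SV k m → Carrier
    X     : Fin m → Fin m → Bool
    Γ-sym : ∀ a b → Γ a b ≡ Γ b a
    Δ-sym : ∀ a b → Δ a b ≡ Δ b a
    Γ-irr : ∀ a → Γ a a ≡ false
    Δ-irr : ∀ a → Δ a a ≡ false
    disjoint : ∀ a b → Γ a b ≡ true → Δ a b ≡ false
    ε-Γ   : ∀ a b → Γ a b ≡ true → ε a ≢ ε b
    ε-Δ   : ∀ a b → Δ a b ≡ true → ε a ≢ ε b
    ι-Γ   : ∀ a b → Γ (ι a) (ι b) ≡ Γ a b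
    ι-Δ   : ∀ a b → Δ (ι a) (ι b) ≡ Δ a b
    ι-ε   : ∀ a → ε (ι a) ≡ ε a
    ι-ρ   : ∀ a → ρ (ι a) ≡ ρ a
    X-sym : ∀ i j → X i j ≡ X j i
    X-irr : ∀ i → X i i ≡ false

Recurrent : ∀ {R k m} → SLB R k m → Set
Recurrent {R} {k} {m} B = ∀ a b →
  sumℕ (map (λ c → toℕ (Γ a c) ℕ.* toℕ (Δ c b)) (vertices k m)) ≡
  sumℕ (map (λ c → toℕ (Δ a c) ℕ.* toℕ (Γ c b)) (vertices k m))
  where open SLB B

record IsDual {R : RealField} {k m : ℕ} (s : RealField.Carrier R)
              (B : SLB R k m) (B* : SLB R m k) : Set where
  open RealField R using (_*_)
  open SLB B
  open SLB B* renaming (Γ to Γ*; Δ to Δ*; ε to ε*; ρ to ρ*; X to X*)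
  field
    ε-zero  : ∀ (i : Fin k) → ε* (zero i) ≡ ε (plus i)
    ε-plus  : ∀ (j : Fin m) → ε* (plus j) ≡ ε (zero j)
    ε-minus : ∀ (j : Fin m) → ε* (minus j) ≡ ε (zero j)
    ρ-zero  : ∀ (i : Fin k) → ρ* (zero i) ≡ s * ρ (plus i)
    ρ-plus  : ∀ (j : Fin m) → s * ρ* (plus j) ≡ ρ (zero j)
    ρ-minus : ∀ (j : Fin m) → s * ρ* (minus j) ≡ ρ (zero j)
    Γ-X   : ∀ (j j' : Fin m) → Γ (zero j) (zero j') ∧ X j j' ≡
              Γ* (plus j) (minus j') ∧ Γ* (minus j) (plus j')
    Γ-nX  : ∀ (j j' : Fin m) → Γ (zero j) (zero j') ∧ not (X j j') ≡
              Γ* (plus j) (plus j') ∧ Γ* (minus j) (minus j')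
    Γ-mix : ∀ (i : Fin k) (j : Fin m) →
              (Γ (plus i) (zero j) ≡ Γ* (zero i) (plus j)) ×
              (Γ (minus i) (zero j) ≡ Γ* (zero i) (minus j))
    Γ-same : ∀ (i i' : Fin k) → Γ (plus i) (plus i') ∧ Γ (minus i) (minus i') ≡
              Γ* (zero i) (zero i') ∧ not (X* i i')
    Γ-opp  : ∀ (i i' : Fin k) → Γ (plus i) (minus i') ∧ Γ (minus i) (plus i') ≡
              Γ* (zero i) (zero i') ∧ X* i i'
    Δ-X   : ∀ (j j' : Fin m) → Δ (zero j) (zero j') ∧ X j j' ≡
              Δ* (plus j) (minus j') ∧ Δ* (minus j) (plus j')
    Δ-nX  : ∀ (j j' : Fin m) → Δ (zero j) (zero j') ∧ not (X j j') ≡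
              Δ* (plus j) (plus j') ∧ Δ* (minus j) (minus j')
    Δ-mix : ∀ (i : Fin k) (j : Fin m) →
              (Δ (plus i) (zero j) ≡ Δ* (zero i) (plus j)) ×
              (Δ (minus i) (zero j) ≡ Δ* (zero i) (minus j))
    Δ-same : ∀ (i i' : Fin k) → Δ (plus i) (plus i') ∧ Δ (minus i) (minus i') ≡
              Δ* (zero i) (zero i') ∧ not (X* i i')
    Δ-opp  : ∀ (i i' : Fin k) → Δ (plus i) (minus i') ∧ Δ (minus i) (plus i') ≡
              Δ* (zero i) (zero i') ∧ X* i i'

-- Tropical T-system of the bipartite bigraph underlying B with initial
-- data λ.  f t v stands for 𝔱^λ_v(t); only values with t + ε_v even are
-- meaningful (others are unconstrained and ignored).

IsTropicalT : ∀ {R k m} (B : SLB R k m) →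
              (SV k m → RealField.Carrier R) →
              (ℤ → SV k m → RealField.Carrier R) → Set
IsTropicalT {R} {k} {m} B λ₀ f =
  (∀ v → f (toℤ (ε v)) v ≡ λ₀ v) ×
  (∀ t v → Odd (t ℤ.+ toℤ (ε v)) →
     f (t ℤ.+ + 1) v + f (t ℤ.- + 1) v ≡
       max (sumR (map (λ u → if Γ u v then f t u else 0#) (vertices k m)))
           (sumR (map (λ w → if Δ v w then f t w else 0#) (vertices k m))))
  where open RealField R
        open SLB B

Periodic : ∀ {R k m} (B : SLB R k m) → ℕ →
           (ℤ → SV k m → RealField.Carrier R) → Set
Periodic B N f = ∀ t v → Even (t ℤ.+ toℤ (SLB.ε B v)) →
                 f (t ℤ.+ + (2 ℕ.* N)) v ≡ f t v

module Submission where

-- Idea (folding).  Call configurations x on V and y on V* folded at colour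
-- c if at every vertex of colour c
--     x(v⁻ᵢ) = x(v⁺ᵢ),   y(uᵢ) = √2·x(v⁺ᵢ),   √2·y(u±ⱼ) = x(vⱼ).
-- This condition is linear and, as √2 ≥ 0, stable under pointwise max.  The
-- edge rules of duality match the neighbour sums of B* with those of B block
-- by block, so the T-system right-hand sides of a pair folded at colour c
-- are folded at the opposite colour.  The initial data (ρ, ρ*) are folded,
-- hence by two-sided induction on time (𝔱^ρ(t), 𝔱^{ρ*}(t)) is folded at every
-- t, at the colour living at time t.  Of two folded pairs, the B-parts agree
-- iff the B*-parts do; comparing times t and t + 2N gives the corollary.

open import Defs
open import Data.Nat using (ℕ; _≤_)
open import Data.Integer using (ℤ)
open import Function.Bundles using (_⇔_; mk⇔)

open import Level using (0ℓ)
open import Function using (_∘_)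
open import Data.Bool using (Bool; true; false; _∧_; not; if_then_else_)
open import Data.Bool.Properties using (∧-idem; not-involutive)
import Data.Nat as ℕ
import Data.Nat.Properties as ℕₚ
import Data.Integer.Properties as ℤₚ
open import Data.Fin using (Fin)
open import Data.List using (List; []; _∷_; map; _++_; allFin)
import Data.List.Properties as Listₚ
import Data.Integer as Int
open import Data.Integer.Tactic.RingSolver using (solve-∀)
open import Data.Product using (_×_; _,_; proj₁; proj₂)
open import Data.Sum using (inj₁; inj₂)
open import Relation.Nullary using (¬_)
open import Data.Empty using (⊥-elim)
open import Relation.Binary.PropositionalEquality
open import Algebra.Bundles using (CommutativeRing)
open import Algebra.Structures using (IsCommutativeRing)
open import Relation.Binary.Structures using (IsTotalOrder)

-- Time.  A value 𝔱_v(t) of a T-system lives at the times t with t + ε_v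
-- even, and the recurrence at v is imposed at the times with t + ε_v odd,
-- linking the two neighbouring times t ± 1.  Parity bookkeeping, and the
-- two-sided induction along which the T-system is unfolded.

module Time where
  open Int using (_+_; _-_; +_; -[1+_])

  odd⇒even-suc : ∀ {a} → Odd a → Even (a + + 1)
  odd⇒even-suc (q , refl) = q + + 1 , lemma q
    where
    lemma : ∀ q → (+ 1 + (q + q)) + + 1 ≡ (q + + 1) + (q + + 1)
    lemma = solve-∀

  odd⇒even-pred : ∀ {a} → Odd a → Even (a - + 1)
  odd⇒even-pred (q , refl) = q , lemma q
    where
    lemma : ∀ q → (+ 1 + (q + q)) - + 1 ≡ q + q
    lemma = solve-∀

  even-suc⇒odd : ∀ {a} → Even (a + + 1) → Odd a
  even-suc⇒odd {a} (q , e) = q - + 1 , trans (back a) (trans (cong (_- + 1) e) (lemma q))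
    where
    back : ∀ a → a ≡ (a + + 1) - + 1
    back = solve-∀
    lemma : ∀ q → (q + q) - + 1 ≡ + 1 + ((q - + 1) + (q - + 1))
    lemma = solve-∀

  even-pred⇒odd : ∀ {a} → Even (a - + 1) → Odd a
  even-pred⇒odd {a} (q , e) = q , trans (back a) (trans (cong (_+ + 1) e) (lemma q))
    where
    back : ∀ a → a ≡ (a - + 1) + + 1
    back = solve-∀
    lemma : ∀ q → (q + q) + + 1 ≡ + 1 + (q + q)
    lemma = solve-∀

  suc-shift : ∀ t x → (t + + 1) + x ≡ (t + x) + + 1
  suc-shift = solve-∀

  pred-shift : ∀ t x → (t - + 1) + x ≡ (t + x) - + 1
  pred-shift = solve-∀

  odd⇒even-not : ∀ t b → Odd (t + toℤ b) → Even (t + toℤ (not b))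
  odd⇒even-not t false o = subst Even (lemma t) (odd⇒even-suc o)
    where
    lemma : ∀ t → (t + + 0) + + 1 ≡ t + + 1
    lemma = solve-∀
  odd⇒even-not t true o = subst Even (lemma t) (odd⇒even-pred o)
    where
    lemma : ∀ t → (t + + 1) - + 1 ≡ t + + 0
    lemma = solve-∀

  even-shift : ∀ t x N → Even (t + x) → Even ((t + + (2 ℕ.* N)) + x)
  even-shift t x N (q , e) = q + + N , trans (cong (λ d → (t + d) + x) double)
      (trans (lemma t x (+ N)) (trans (cong (λ a → a + (+ N + + N)) e) (regroup q (+ N))))
    where
    double : + (2 ℕ.* N) ≡ + N + + N
    double = cong (λ n → + (N ℕ.+ n)) (ℕₚ.+-identityʳ N)
    lemma : ∀ t x n → (t + (n + n)) + x ≡ (t + x) + (n + n)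
    lemma = solve-∀
    regroup : ∀ q n → (q + q) + (n + n) ≡ (q + n) + (q + n)
    regroup = solve-∀

  ¬even-one : ¬ Even (+ 1)
  ¬even-one (+ 0 , ())
  ¬even-one (+ ℕ.suc n , e) =
    ℕₚ.0≢1+n (trans (ℕₚ.suc-injective (ℤₚ.+-injective e)) (ℕₚ.+-suc n n))
  ¬even-one (-[1+ n ] , ())

  even-colour : ∀ b c → Even (toℤ b + toℤ c) → c ≡ b
  even-colour false false _ = refl
  even-colour true  true  _ = refl
  even-colour false true  e = ⊥-elim (¬even-one e)
  even-colour true  false e = ⊥-elim (¬even-one e)

  ℤ-induction₂ : (P : ℤ → Set) → P (+ 0) → P (+ 1) →
    (∀ t → P (t - + 1) → P t → P (t + + 1)) →
    (∀ t → P (t + + 1) → P t → P (t - + 1)) →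
    ∀ t → P t
  ℤ-induction₂ P p₀ p₁ up down t = proj₁ (pairs t)
    where
    Pair : ℤ → Set
    Pair t = P t × P (t + + 1)

    forward : ∀ t → Pair t → Pair (t + + 1)
    forward t (p , p′) = p′ , up (t + + 1) (subst P (back t) p) p′
      where
      back : ∀ t → t ≡ (t + + 1) - + 1
      back = solve-∀

    backward : ∀ t → Pair t → Pair (t - + 1)
    backward t (p , p′) = down t p′ p , subst P (back t) p
      where
      back : ∀ t → t ≡ (t - + 1) + + 1
      back = solve-∀

    nonnegative : ∀ n → Pair (+ n)
    nonnegative ℕ.zero    = p₀ , p₁
    nonnegative (ℕ.suc n) = subst Pair (cong +_ (ℕₚ.+-comm n 1)) (forward (+ n) (nonnegative n))

    negative : ∀ n → Pair -[1+ n ]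
    negative ℕ.zero    = backward (+ 0) (nonnegative 0)
    negative (ℕ.suc n) =
      subst Pair (cong (λ n → -[1+ ℕ.suc n ]) (ℕₚ.+-identityʳ n)) (backward -[1+ n ] (negative n))

    pairs : ∀ t → Pair t
    pairs (+ n)    = nonnegative n
    pairs -[1+ n ] = negative n

module FieldFacts (R : RealField) where
  open RealField R renaming (_≤_ to _≼_)
  open IsCommutativeRing isCommutativeRing using
    (+-assoc; +-identityˡ; +-identityʳ; -‿inverseʳ; -‿inverseˡ;
     *-comm; *-assoc; *-identityˡ; distribˡ; zeroʳ)
  open IsTotalOrder isTotalOrder using (antisym)
  open ≡-Reasoning

  commutativeRing : CommutativeRing 0ℓ 0ℓ
  commutativeRing = record { isCommutativeRing = isCommutativeRing }

  open import Algebra.Properties.Group (CommutativeRing.+-group commutativeRing)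
    using (∙-cancelʳ)
  open import Algebra.Properties.CommutativeSemigroup
    (CommutativeRing.+-commutativeSemigroup commutativeRing) using (interchange)

  +-cancelʳ : ∀ {x y} z → x + z ≡ y + z → x ≡ y
  +-cancelʳ {x} {y} z = ∙-cancelʳ z x y

  *-cancelˡ : ∀ {a x y} → a ≢ 0# → a * x ≡ a * y → x ≡ y
  *-cancelˡ {a} {x} {y} a≢0 e with inverse a a≢0
  ... | a⁻¹ , aa⁻¹ = begin
    x               ≡⟨ sym (*-identityˡ x) ⟩
    1# * x          ≡⟨ cong (_* x) (trans (sym aa⁻¹) (*-comm a a⁻¹)) ⟩
    (a⁻¹ * a) * x   ≡⟨ *-assoc a⁻¹ a x ⟩
    a⁻¹ * (a * x)   ≡⟨ cong (a⁻¹ *_) e ⟩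
    a⁻¹ * (a * y)   ≡⟨ sym (*-assoc a⁻¹ a y) ⟩
    (a⁻¹ * a) * y   ≡⟨ cong (_* y) (trans (*-comm a⁻¹ a) aa⁻¹) ⟩
    1# * y          ≡⟨ *-identityˡ y ⟩
    y               ∎

  -- multiplication by a nonnegative element is monotone, hence commutes with max
  *-monoˡ-≼ : ∀ {a x y} → 0# ≼ a → x ≼ y → a * x ≼ a * y
  *-monoˡ-≼ {a} {x} {y} a≥0 x≤y = subst₂ _≼_ (+-identityˡ (a * x)) shifted
    (+-mono (a * x) (*-pos a≥0 gap))
    where
    gap : 0# ≼ y + - x
    gap = subst (_≼ y + - x) (-‿inverseʳ x) (+-mono (- x) x≤y)
    shifted : a * (y + - x) + a * x ≡ a * y
    shifted = begin
      a * (y + - x) + a * x  ≡⟨ sym (distribˡ a (y + - x) x) ⟩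
      a * ((y + - x) + x)    ≡⟨ cong (a *_) (+-assoc y (- x) x) ⟩
      a * (y + (- x + x))    ≡⟨ cong (λ z → a * (y + z)) (-‿inverseˡ x) ⟩
      a * (y + 0#)           ≡⟨ cong (a *_) (+-identityʳ y) ⟩
      a * y                  ∎

  *-max : ∀ {a} → 0# ≼ a → ∀ x y → a * max x y ≡ max (a * x) (a * y)
  *-max {a} a≥0 x y with total x y | total (a * x) (a * y)
  ... | inj₁ _   | inj₁ _    = refl
  ... | inj₁ x≤y | inj₂ ay≤ax = antisym ay≤ax (*-monoˡ-≼ a≥0 x≤y)
  ... | inj₂ y≤x | inj₁ ax≤ay = antisym ax≤ay (*-monoˡ-≼ a≥0 y≤x)
  ... | inj₂ _   | inj₂ _    = refl

  [_]·_ : Bool → Carrier → Carrier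
  [ b ]· x = if b then x else 0#

  guard-cong : ∀ {b b′ x y} → b ≡ b′ → (b′ ≡ true → x ≡ y) → [ b ]· x ≡ [ b′ ]· y
  guard-cong {false} refl _ = refl
  guard-cong {true}  refl p = p refl

  guard-scale : ∀ a b x → a * ([ b ]· x) ≡ [ b ]· (a * x)
  guard-scale a false x = zeroʳ a
  guard-scale a true  x = refl

  scale-guards : ∀ a b b′ x x′ → a * ([ b ]· x + [ b′ ]· x′) ≡ [ b ]· (a * x) + [ b′ ]· (a * x′)
  scale-guards a b b′ x x′ =
    trans (distribˡ a ([ b ]· x) ([ b′ ]· x′)) (cong₂ _+_ (guard-scale a b x) (guard-scale a b′ x′))

  guard-split : ∀ {b b′ c x x′ z} → b ≡ c → b′ ≡ c → (c ≡ true → z ≡ x + x′) →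
                [ c ]· z ≡ [ b ]· x + [ b′ ]· x′
  guard-split {c = false} refl refl _ = sym (+-identityˡ 0#)
  guard-split {c = true}  refl refl p = p refl

  guard-select : ∀ b b′ c d {x x′ z} → b ≡ c ∧ not d → b′ ≡ c ∧ d →
                 (c ≡ true → z ≡ x) → (c ≡ true → z ≡ x′) →
                 [ c ]· z ≡ [ b ]· x + [ b′ ]· x′
  guard-select _ _ false d  refl refl _ _ = sym (+-identityˡ 0#)
  guard-select _ _ true false refl refl p _ = trans (p refl) (sym (+-identityʳ _))
  guard-select _ _ true true  refl refl _ q = trans (q refl) (sym (+-identityˡ _))

  ΣL : {A : Set} → (A → Carrier) → List A → Carrier
  ΣL h xs = sumR (map h xs)

  ΣL-++ : ∀ {A : Set} (h : A → Carrier) xs ys → ΣL h (xs ++ ys) ≡ ΣL h xs + ΣL h ys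
  ΣL-++ h []       ys = sym (+-identityˡ _)
  ΣL-++ h (x ∷ xs) ys = trans (cong (h x +_) (ΣL-++ h xs ys)) (sym (+-assoc (h x) _ _))

  ΣL-map : ∀ {A B : Set} (h : B → Carrier) (g : A → B) xs → ΣL h (map g xs) ≡ ΣL (h ∘ g) xs
  ΣL-map h g xs = cong sumR (sym (Listₚ.map-∘ xs))

  ΣL-cong : ∀ {A : Set} {h h′ : A → Carrier} xs → (∀ x → h x ≡ h′ x) → ΣL h xs ≡ ΣL h′ xs
  ΣL-cong xs p = cong sumR (Listₚ.map-cong p xs)

  ΣL-+ : ∀ {A : Set} (h h′ : A → Carrier) xs → ΣL (λ x → h x + h′ x) xs ≡ ΣL h xs + ΣL h′ xs
  ΣL-+ h h′ []       = sym (+-identityˡ 0#)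
  ΣL-+ h h′ (x ∷ xs) = trans (cong (h x + h′ x +_) (ΣL-+ h h′ xs)) (interchange (h x) (h′ x) _ _)

  record Additive (φ : Carrier → Carrier) : Set where
    field
      map-0 : φ 0# ≡ 0#
      map-+ : ∀ x y → φ (x + y) ≡ φ x + φ y

  ΣL-additive : ∀ {A : Set} {φ} → Additive φ → (h : A → Carrier) (xs : List A) →
                φ (ΣL h xs) ≡ ΣL (φ ∘ h) xs
  ΣL-additive φ-add h []       = Additive.map-0 φ-add
  ΣL-additive φ-add h (x ∷ xs) =
    trans (Additive.map-+ φ-add (h x) _) (cong (_ +_) (ΣL-additive φ-add h xs))

  id-additive : Additive (λ x → x)
  id-additive = record { map-0 = refl ; map-+ = λ _ _ → refl }

  scale-additive : ∀ a → Additive (a *_)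
  scale-additive a = record { map-0 = zeroʳ a ; map-+ = distribˡ a }

-- Sums over the vertex set V = V₊ ⊔ V₋ ⊔ V₀ of a symmetric bigraph, grouped
-- into the pairs {v⁺ᵢ, v⁻ᵢ} and the fixed vertices vⱼ.

module VertexSums (R : RealField) where
  open RealField R
  open IsCommutativeRing isCommutativeRing using (+-assoc; +-comm)
  open FieldFacts R
  open ≡-Reasoning

  pairBlock : ∀ {k m} → (SV k m → Carrier) → Carrier
  pairBlock {k} F = ΣL (λ i → F (plus i) + F (minus i)) (allFin k)

  fixedBlock : ∀ {k m} → (SV k m → Carrier) → Carrier
  fixedBlock {m = m} F = ΣL (F ∘ zero) (allFin m)

  sum-blocks : ∀ {k m} (F : SV k m → Carrier) → ΣL F (vertices k m) ≡ pairBlock F + fixedBlock F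
  sum-blocks {k} {m} F = begin
    ΣL F (map plus (allFin k) ++ map minus (allFin k) ++ map zero (allFin m))
      ≡⟨ ΣL-++ F (map plus (allFin k)) _ ⟩
    ΣL F (map plus (allFin k)) + ΣL F (map minus (allFin k) ++ map zero (allFin m))
      ≡⟨ cong (ΣL F (map plus (allFin k)) +_) (ΣL-++ F (map minus (allFin k)) _) ⟩
    ΣL F (map plus (allFin k)) + (ΣL F (map minus (allFin k)) + ΣL F (map zero (allFin m)))
      ≡⟨ sym (+-assoc _ _ _) ⟩
    (ΣL F (map plus (allFin k)) + ΣL F (map minus (allFin k))) + ΣL F (map zero (allFin m))
      ≡⟨ cong₂ _+_ (trans (cong₂ _+_ (ΣL-map F plus (allFin k)) (ΣL-map F minus (allFin k)))
                          (sym (ΣL-+ (F ∘ plus) (F ∘ minus) (allFin k))))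
                   (ΣL-map F zero (allFin m)) ⟩
    pairBlock F + fixedBlock F
      ∎

  fold-sum : ∀ {k m φ ψ} → Additive φ → Additive ψ →
    (F : SV k m → Carrier) (G : SV m k → Carrier) →
    (∀ i → φ (G (zero i)) ≡ ψ (F (plus i) + F (minus i))) →
    (∀ j → φ (G (plus j) + G (minus j)) ≡ ψ (F (zero j))) →
    φ (ΣL G (vertices m k)) ≡ ψ (ΣL F (vertices k m))
  fold-sum {k} {m} {φ} {ψ} φ-add ψ-add F G fixed-vs-pair pair-vs-fixed = begin
    φ (ΣL G (vertices m k))              ≡⟨ cong φ (sum-blocks G) ⟩
    φ (pairBlock G + fixedBlock G)       ≡⟨ Additive.map-+ φ-add _ _ ⟩
    φ (pairBlock G) + φ (fixedBlock G)
      ≡⟨ cong₂ _+_ (ΣL-additive φ-add _ (allFin m)) (ΣL-additive φ-add _ (allFin k)) ⟩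
    ΣL (λ j → φ (G (plus j) + G (minus j))) (allFin m) + ΣL (φ ∘ G ∘ zero) (allFin k)
      ≡⟨ cong₂ _+_ (ΣL-cong (allFin m) pair-vs-fixed) (ΣL-cong (allFin k) fixed-vs-pair) ⟩
    ΣL (ψ ∘ F ∘ zero) (allFin m) + ΣL (λ i → ψ (F (plus i) + F (minus i))) (allFin k)
      ≡⟨ sym (cong₂ _+_ (ΣL-additive ψ-add _ (allFin m)) (ΣL-additive ψ-add _ (allFin k))) ⟩
    ψ (fixedBlock F) + ψ (pairBlock F)   ≡⟨ +-comm _ _ ⟩
    ψ (pairBlock F) + ψ (fixedBlock F)   ≡⟨ sym (Additive.map-+ ψ-add _ _) ⟩
    ψ (pairBlock F + fixedBlock F)       ≡⟨ cong ψ (sym (sum-blocks F)) ⟩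
    ψ (ΣL F (vertices k m))              ∎

  ι-neighbour-sum : ∀ {k m} (E : SV k m → SV k m → Bool) → (∀ a b → E (ι a) (ι b) ≡ E a b) →
    (h : SV k m → Carrier) (i₀ : Fin k) → (∀ a → E a (plus i₀) ≡ true → h (ι a) ≡ h a) →
    ΣL (λ u → [ E u (minus i₀) ]· h u) (vertices k m) ≡
    ΣL (λ u → [ E u (plus i₀) ]· h u) (vertices k m)
  ι-neighbour-sum {k} {m} E ι-E h i₀ h-ι = begin
    ΣL F⁻ (vertices k m)             ≡⟨ sum-blocks F⁻ ⟩
    pairBlock F⁻ + fixedBlock F⁻     ≡⟨ cong₂ _+_ (ΣL-cong (allFin k) swap-pair)
                                                  (ΣL-cong (allFin m) λ j → cong (λ b → [ b ]· _) (ι-E (zero j) (plus i₀))) ⟩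
    pairBlock F⁺ + fixedBlock F⁺     ≡⟨ sym (sum-blocks F⁺) ⟩
    ΣL F⁺ (vertices k m)             ∎
    where
    F⁻ F⁺ : SV k m → Carrier
    F⁻ u = [ E u (minus i₀) ]· h u
    F⁺ u = [ E u (plus i₀) ]· h u
    swap-pair : ∀ i → F⁻ (plus i) + F⁻ (minus i) ≡ F⁺ (plus i) + F⁺ (minus i)
    swap-pair i = trans (cong₂ _+_ (guard-cong (ι-E (minus i) (plus i₀)) (h-ι (minus i)))
                                   (guard-cong (ι-E (plus i) (plus i₀)) (h-ι (plus i))))
                        (+-comm _ _)

  tropical-rhs : ∀ {k m} → SLB R k m → (SV k m → Carrier) → SV k m → Carrier
  tropical-rhs {k} {m} C x v =
    max (ΣL (λ u → [ Γ u v ]· x u) (vertices k m)) (ΣL (λ w → [ Δ v w ]· x w) (vertices k m))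
    where open SLB C

opposite-colour : ∀ {a b c} → a ≢ b → b ≡ not c → a ≡ c
opposite-colour {false} {c = false} _  refl = refl
opposite-colour {true}  {c = true}  _  refl = refl
opposite-colour {false} {c = true}  ne refl = ⊥-elim (ne refl)
opposite-colour {true}  {c = false} ne refl = ⊥-elim (ne refl)

-- Folded configurations of a symmetric labeled bigraph B and its dual B*,
-- with s = √2.

module Folding (R : RealField) (s : RealField.Carrier R) (s-is-√2 : IsSqrt2 R s)
  {k m : ℕ} (B : SLB R k m) (B* : SLB R m k) (duality : IsDual s B B*) where
  open RealField R renaming (_≤_ to _≼_)
  open IsCommutativeRing isCommutativeRing using (+-comm; *-assoc; *-identityˡ; distribˡ; distribʳ)
  open FieldFacts R
  open VertexSums R
  open SLB B
  module B* = SLB B*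
  open IsDual duality
  open ≡-Reasoning

  s≢0 : s ≢ 0#
  s≢0 s≡0 = proj₂ (proj₁ s-is-√2) (sym s≡0)

  s≥0 : 0# ≼ s
  s≥0 = proj₁ (proj₁ s-is-√2)

  s*s* : ∀ x → s * (s * x) ≡ x + x
  s*s* x = begin
    s * (s * x)              ≡⟨ sym (*-assoc s s x) ⟩
    (s * s) * x              ≡⟨ cong (_* x) (proj₂ s-is-√2) ⟩
    (1# + 1#) * x            ≡⟨ distribʳ x 1# 1# ⟩
    1# * x + 1# * x          ≡⟨ cong₂ _+_ (*-identityˡ x) (*-identityˡ x) ⟩
    x + x                    ∎

  halves : ∀ {x x′ y} → s * x ≡ y → s * x′ ≡ y → x + x′ ≡ s * y
  halves {x} {x′} {y} sx≡y sx′≡y = *-cancelˡ s≢0 (begin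
    s * (x + x′)     ≡⟨ distribˡ s x x′ ⟩
    s * x + s * x′   ≡⟨ cong₂ _+_ sx≡y sx′≡y ⟩
    y + y            ≡⟨ sym (s*s* y) ⟩
    s * (s * y)      ∎)

  Config : Set
  Config = SV k m → Carrier

  Config* : Set
  Config* = SV m k → Carrier

  _≈[_]_ : Config → Bool → Config → Set
  x ≈[ c ] x′ = ∀ v → ε v ≡ c → x v ≡ x′ v

  _≈*[_]_ : Config* → Bool → Config* → Set
  y ≈*[ c ] y′ = ∀ w → B*.ε w ≡ c → y w ≡ y′ w

  -- x and y are folded at colour c: at the vertices of colour c, x is
  -- ι-invariant and y is x carried over by the duality, with the scalings
  -- ρ*(uᵢ) = √2 ρ(v⁺ᵢ) and √2 ρ*(u±ⱼ) = ρ(vⱼ) of the dual labelling.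
  record Folded (c : Bool) (x : Config) (y : Config*) : Set where
    field
      sym-at   : ∀ i → ε (plus i) ≡ c → x (minus i) ≡ x (plus i)
      zero-at  : ∀ i → ε (plus i) ≡ c → y (zero i) ≡ s * x (plus i)
      plus-at  : ∀ j → ε (zero j) ≡ c → s * y (plus j) ≡ x (zero j)
      minus-at : ∀ j → ε (zero j) ≡ c → s * y (minus j) ≡ x (zero j)

    dual-sym-at : ∀ j → ε (zero j) ≡ c → y (minus j) ≡ y (plus j)
    dual-sym-at j e = *-cancelˡ s≢0 (trans (minus-at j e) (sym (plus-at j e)))

  open Folded

  colour-minus : ∀ {c} i → ε (minus i) ≡ c → ε (plus i) ≡ c
  colour-minus i = trans (sym (ι-ε (plus i)))

  colour-zero* : ∀ {c} i → B*.ε (zero i) ≡ c → ε (plus i) ≡ c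
  colour-zero* i = trans (sym (ε-zero i))

  colour-plus* : ∀ {c} j → B*.ε (plus j) ≡ c → ε (zero j) ≡ c
  colour-plus* j = trans (sym (ε-plus j))

  colour-minus* : ∀ {c} j → B*.ε (minus j) ≡ c → ε (zero j) ≡ c
  colour-minus* j = trans (sym (ε-minus j))

  initial-folded : ∀ c → Folded c ρ B*.ρ
  initial-folded c = record
    { sym-at   = λ i _ → ι-ρ (plus i)
    ; zero-at  = λ i _ → ρ-zero i
    ; plus-at  = λ j _ → ρ-plus j
    ; minus-at = λ j _ → ρ-minus j
    }

  folded-resp : ∀ {c x x′ y y′} → x ≈[ c ] x′ → y ≈*[ c ] y′ → Folded c x y → Folded c x′ y′
  folded-resp {c} {x} {x′} {y} {y′} x≈x′ y≈y′ F = record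
    { sym-at   = λ i e → trans (sym (x≈x′ (minus i) (trans (ι-ε (plus i)) e)))
                               (trans (sym-at F i e) (x≈x′ (plus i) e))
    ; zero-at  = λ i e → trans (sym (y≈y′ (zero i) (trans (ε-zero i) e)))
                               (trans (zero-at F i e) (cong (s *_) (x≈x′ (plus i) e)))
    ; plus-at  = λ j e → trans (cong (s *_) (sym (y≈y′ (plus j) (trans (ε-plus j) e))))
                               (trans (plus-at F j e) (x≈x′ (zero j) e))
    ; minus-at = λ j e → trans (cong (s *_) (sym (y≈y′ (minus j) (trans (ε-minus j) e))))
                               (trans (minus-at F j e) (x≈x′ (zero j) e))
    }

  -- foldedness is a linear condition: it passes to differences
  folded-cancel : ∀ {c x x′ y y′} →
    Folded c (λ v → x v + x′ v) (λ w → y w + y′ w) → Folded c x′ y′ → Folded c x y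
  folded-cancel {c} {x} {x′} {y} {y′} F F′ = record
    { sym-at   = λ i e → +-cancelʳ (x′ (plus i)) (begin
        x (minus i) + x′ (plus i)    ≡⟨ cong (x (minus i) +_) (sym (sym-at F′ i e)) ⟩
        x (minus i) + x′ (minus i)   ≡⟨ sym-at F i e ⟩
        x (plus i) + x′ (plus i)     ∎)
    ; zero-at  = λ i e → +-cancelʳ (y′ (zero i)) (begin
        y (zero i) + y′ (zero i)           ≡⟨ zero-at F i e ⟩
        s * (x (plus i) + x′ (plus i))     ≡⟨ distribˡ s _ _ ⟩
        s * x (plus i) + s * x′ (plus i)   ≡⟨ cong (s * x (plus i) +_) (sym (zero-at F′ i e)) ⟩
        s * x (plus i) + y′ (zero i)       ∎)
    ; plus-at  = λ j e → +-cancelʳ (s * y′ (plus j)) (begin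
        s * y (plus j) + s * y′ (plus j)   ≡⟨ sym (distribˡ s _ _) ⟩
        s * (y (plus j) + y′ (plus j))     ≡⟨ plus-at F j e ⟩
        x (zero j) + x′ (zero j)           ≡⟨ cong (x (zero j) +_) (sym (plus-at F′ j e)) ⟩
        x (zero j) + s * y′ (plus j)       ∎)
    ; minus-at = λ j e → +-cancelʳ (s * y′ (minus j)) (begin
        s * y (minus j) + s * y′ (minus j) ≡⟨ sym (distribˡ s _ _) ⟩
        s * (y (minus j) + y′ (minus j))   ≡⟨ minus-at F j e ⟩
        x (zero j) + x′ (zero j)           ≡⟨ cong (x (zero j) +_) (sym (minus-at F′ j e)) ⟩
        x (zero j) + s * y′ (minus j)      ∎)
    }

  -- since s ≥ 0, foldedness is preserved by pointwise max
  folded-max : ∀ {c x x′ y y′} → Folded c x y → Folded c x′ y′ →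
    Folded c (λ v → max (x v) (x′ v)) (λ w → max (y w) (y′ w))
  folded-max F F′ = record
    { sym-at   = λ i e → cong₂ max (sym-at F i e) (sym-at F′ i e)
    ; zero-at  = λ i e → trans (cong₂ max (zero-at F i e) (zero-at F′ i e)) (sym (*-max s≥0 _ _))
    ; plus-at  = λ j e → trans (*-max s≥0 _ _) (cong₂ max (plus-at F j e) (plus-at F′ j e))
    ; minus-at = λ j e → trans (*-max s≥0 _ _) (cong₂ max (minus-at F j e) (minus-at F′ j e))
    }

  folded-agree* : ∀ {c x x′ y y′} → Folded c x y → Folded c x′ y′ → x ≈[ c ] x′ → y ≈*[ c ] y′
  folded-agree* F F′ x≈x′ (zero i) e = let e′ = colour-zero* i e in
    trans (zero-at F i e′) (trans (cong (s *_) (x≈x′ (plus i) e′)) (sym (zero-at F′ i e′)))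
  folded-agree* F F′ x≈x′ (plus j) e = let e′ = colour-plus* j e in
    *-cancelˡ s≢0 (trans (plus-at F j e′) (trans (x≈x′ (zero j) e′) (sym (plus-at F′ j e′))))
  folded-agree* F F′ x≈x′ (minus j) e = let e′ = colour-minus* j e in
    *-cancelˡ s≢0 (trans (minus-at F j e′) (trans (x≈x′ (zero j) e′) (sym (minus-at F′ j e′))))

  folded-agree : ∀ {c x x′ y y′} → Folded c x y → Folded c x′ y′ → y ≈*[ c ] y′ → x ≈[ c ] x′
  folded-agree F F′ y≈y′ (plus i) e = *-cancelˡ s≢0
    (trans (sym (zero-at F i e)) (trans (y≈y′ (zero i) (trans (ε-zero i) e)) (zero-at F′ i e)))
  folded-agree F F′ y≈y′ (minus i) e = let e′ = colour-minus i e in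
    trans (sym-at F i e′) (trans (folded-agree F F′ y≈y′ (plus i) e′) (sym (sym-at F′ i e′)))
  folded-agree F F′ y≈y′ (zero j) e =
    trans (sym (plus-at F j e)) (trans (cong (s *_) (y≈y′ (plus j) (trans (ε-plus j) e))) (plus-at F′ j e))

  record DualEdges : Set where
    field
      E       : SV k m → SV k m → Bool
      E*      : SV m k → SV m k → Bool
      E-sym   : ∀ a b → E a b ≡ E b a
      E*-sym  : ∀ a b → E* a b ≡ E* b a
      ι-E     : ∀ a b → E (ι a) (ι b) ≡ E a b
      ι-E*    : ∀ a b → E* (ι a) (ι b) ≡ E* a b
      E-col   : ∀ a b → E a b ≡ true → ε a ≢ ε b
      E*-col  : ∀ a b → E* a b ≡ true → B*.ε a ≢ B*.ε b
      mixed   : ∀ i j → (E (plus i) (zero j) ≡ E* (zero i) (plus j)) ×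
                        (E (minus i) (zero j) ≡ E* (zero i) (minus j))
      same    : ∀ i i′ → E (plus i) (plus i′) ∧ E (minus i) (minus i′) ≡
                         E* (zero i) (zero i′) ∧ not (B*.X i i′)
      opposed : ∀ i i′ → E (plus i) (minus i′) ∧ E (minus i) (plus i′) ≡
                         E* (zero i) (zero i′) ∧ B*.X i i′
      in-X    : ∀ j j′ → E (zero j) (zero j′) ∧ X j j′ ≡
                         E* (plus j) (minus j′) ∧ E* (minus j) (plus j′)
      not-in-X : ∀ j j′ → E (zero j) (zero j′) ∧ not (X j j′) ≡
                          E* (plus j) (plus j′) ∧ E* (minus j) (minus j′)

    nbr : Config → Config
    nbr x v = ΣL (λ u → [ E u v ]· x u) (vertices k m)

    nbr* : Config* → Config*
    nbr* y w = ΣL (λ u → [ E* u w ]· y u) (vertices m k)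

  ΓEdges : DualEdges
  ΓEdges = record
    { E = Γ ; E* = B*.Γ ; E-sym = Γ-sym ; E*-sym = B*.Γ-sym ; ι-E = ι-Γ ; ι-E* = B*.ι-Γ
    ; E-col = ε-Γ ; E*-col = B*.ε-Γ ; mixed = Γ-mix ; same = Γ-same ; opposed = Γ-opp
    ; in-X = Γ-X ; not-in-X = Γ-nX }

  ΔEdges : DualEdges
  ΔEdges = record
    { E = Δ ; E* = B*.Δ ; E-sym = Δ-sym ; E*-sym = B*.Δ-sym ; ι-E = ι-Δ ; ι-E* = B*.ι-Δ
    ; E-col = ε-Δ ; E*-col = B*.ε-Δ ; mixed = Δ-mix ; same = Δ-same ; opposed = Δ-opp
    ; in-X = Δ-X ; not-in-X = Δ-nX }

  -- Each of the four conditions compares a sum over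
  -- B* with a sum over B block by block (fold-sum), the blocks matching by
  -- the edge rules of duality.
  module NeighbourSums (A : DualEdges) {c : Bool} {x : Config} {y : Config*}
                       (F : Folded c x y) where
    open DualEdges A

    adjacent-colour : ∀ {a v} → E a v ≡ true → ε v ≡ not c → ε a ≡ c
    adjacent-colour {a} {v} adj = opposite-colour (E-col a v adj)

    adjacent-colour* : ∀ {a w} → E* a w ≡ true → B*.ε w ≡ not c → B*.ε a ≡ c
    adjacent-colour* {a} {w} adj = opposite-colour (E*-col a w adj)

    nbr-sym : ∀ i₀ → ε (plus i₀) ≡ not c → nbr x (minus i₀) ≡ nbr x (plus i₀)
    nbr-sym i₀ e = ι-neighbour-sum E ι-E x i₀ x-ι
      where
      x-ι : ∀ a → E a (plus i₀) ≡ true → x (ι a) ≡ x a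
      x-ι (plus i)  adj = sym-at F i (adjacent-colour adj e)
      x-ι (minus i) adj = sym (sym-at F i (colour-minus i (adjacent-colour adj e)))
      x-ι (zero j)  adj = refl

    nbr-zero : ∀ i₀ → ε (plus i₀) ≡ not c → nbr* y (zero i₀) ≡ s * nbr x (plus i₀)
    nbr-zero i₀ e = fold-sum id-additive (scale-additive s) _ _ fixed-vs-pair pair-vs-fixed
      where
      fixed-vs-pair : ∀ i → [ E* (zero i) (zero i₀) ]· y (zero i) ≡
        s * ([ E (plus i) (plus i₀) ]· x (plus i) + [ E (minus i) (plus i₀) ]· x (minus i))
      fixed-vs-pair i = trans
        (guard-select _ _ (E* (zero i) (zero i₀)) (B*.X i i₀) plus-guard minus-guard
          (λ adj → zero-at F i (colour adj))
          (λ adj → trans (zero-at F i (colour adj)) (cong (s *_) (sym (sym-at F i (colour adj))))))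
        (sym (scale-guards s _ _ _ _))
        where
        colour : E* (zero i) (zero i₀) ≡ true → ε (plus i) ≡ c
        colour adj = colour-zero* i (adjacent-colour* adj (trans (ε-zero i₀) e))
        plus-guard : E (plus i) (plus i₀) ≡ E* (zero i) (zero i₀) ∧ not (B*.X i i₀)
        plus-guard = trans (sym (∧-idem _))
          (trans (cong (E (plus i) (plus i₀) ∧_) (sym (ι-E (plus i) (plus i₀)))) (same i i₀))
        minus-guard : E (minus i) (plus i₀) ≡ E* (zero i) (zero i₀) ∧ B*.X i i₀
        minus-guard = trans (sym (∧-idem _))
          (trans (cong (_∧ E (minus i) (plus i₀)) (sym (ι-E (minus i) (plus i₀)))) (opposed i i₀))

      pair-vs-fixed : ∀ j → [ E* (plus j) (zero i₀) ]· y (plus j) + [ E* (minus j) (zero i₀) ]· y (minus j) ≡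
                            s * [ E (zero j) (plus i₀) ]· x (zero j)
      pair-vs-fixed j = trans
        (sym (guard-split plus-guard minus-guard
          (λ adj → let col = adjacent-colour adj e in sym (halves (plus-at F j col) (minus-at F j col)))))
        (sym (guard-scale s _ _))
        where
        plus-guard : E* (plus j) (zero i₀) ≡ E (zero j) (plus i₀)
        plus-guard = trans (E*-sym _ _) (trans (sym (proj₁ (mixed i₀ j))) (E-sym _ _))
        minus-guard : E* (minus j) (zero i₀) ≡ E (zero j) (plus i₀)
        minus-guard = trans (E*-sym _ _)
          (trans (sym (proj₂ (mixed i₀ j))) (trans (ι-E (plus i₀) (zero j)) (E-sym _ _)))

    nbr-plus : ∀ j₀ → ε (zero j₀) ≡ not c → s * nbr* y (plus j₀) ≡ nbr x (zero j₀)
    nbr-plus j₀ e = fold-sum (scale-additive s) id-additive _ _ fixed-vs-pair pair-vs-fixed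
      where
      fixed-vs-pair : ∀ i → s * [ E* (zero i) (plus j₀) ]· y (zero i) ≡
                            [ E (plus i) (zero j₀) ]· x (plus i) + [ E (minus i) (zero j₀) ]· x (minus i)
      fixed-vs-pair i = trans (guard-scale s _ _)
        (guard-split (proj₁ (mixed i j₀)) (trans (ι-E (plus i) (zero j₀)) (proj₁ (mixed i j₀)))
          λ adj → let col = colour-zero* i (adjacent-colour* adj (trans (ε-plus j₀) e)) in
            trans (cong (s *_) (zero-at F i col))
                  (trans (s*s* _) (cong (x (plus i) +_) (sym (sym-at F i col)))))

      pair-vs-fixed : ∀ j → s * ([ E* (plus j) (plus j₀) ]· y (plus j) + [ E* (minus j) (plus j₀) ]· y (minus j)) ≡
                            [ E (zero j) (zero j₀) ]· x (zero j)
      pair-vs-fixed j = trans (scale-guards s _ _ _ _)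
        (sym (guard-select _ _ (E (zero j) (zero j₀)) (X j j₀) plus-guard minus-guard
          (λ adj → sym (plus-at F j (adjacent-colour adj e)))
          (λ adj → sym (minus-at F j (adjacent-colour adj e)))))
        where
        plus-guard : E* (plus j) (plus j₀) ≡ E (zero j) (zero j₀) ∧ not (X j j₀)
        plus-guard = sym (trans (not-in-X j j₀)
          (trans (cong (E* (plus j) (plus j₀) ∧_) (ι-E* (plus j) (plus j₀))) (∧-idem _)))
        minus-guard : E* (minus j) (plus j₀) ≡ E (zero j) (zero j₀) ∧ X j j₀
        minus-guard = sym (trans (in-X j j₀)
          (trans (cong (_∧ E* (minus j) (plus j₀)) (ι-E* (minus j) (plus j₀))) (∧-idem _)))

    nbr-minus : ∀ j₀ → ε (zero j₀) ≡ not c → s * nbr* y (minus j₀) ≡ nbr x (zero j₀)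
    nbr-minus j₀ e = trans (cong (s *_) (ι-neighbour-sum E* ι-E* y j₀ y-ι)) (nbr-plus j₀ e)
      where
      y-ι : ∀ a → E* a (plus j₀) ≡ true → y (ι a) ≡ y a
      y-ι (plus j)  adj = dual-sym-at F j (colour-plus* j (adjacent-colour* adj (trans (ε-plus j₀) e)))
      y-ι (minus j) adj = sym (dual-sym-at F j (colour-minus* j (adjacent-colour* adj (trans (ε-plus j₀) e))))
      y-ι (zero i)  adj = refl

    neighbours-folded : Folded (not c) (nbr x) (nbr* y)
    neighbours-folded = record
      { sym-at = nbr-sym ; zero-at = nbr-zero ; plus-at = nbr-plus ; minus-at = nbr-minus }

  -- Hence the tropical T-system right-hand sides of a pair folded at colour
  -- c are folded at the opposite colour (the Δ-sum is read off in the other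
  -- orientation, and max preserves foldedness).
  rhs-folded : ∀ {c x y} → Folded c x y → Folded (not c) (tropical-rhs B x) (tropical-rhs B* y)
  rhs-folded {c} {x} {y} F = folded-max
    (NeighbourSums.neighbours-folded ΓEdges F)
    (folded-resp (λ v _ → ΣL-cong (vertices k m) λ u → cong (λ b → [ b ]· x u) (Δ-sym u v))
                 (λ w _ → ΣL-cong (vertices m k) λ u → cong (λ b → [ b ]· y u) (B*.Δ-sym u w))
                 (NeighbourSums.neighbours-folded ΔEdges F))

  module Dynamics (f : ℤ → Config) (g : ℤ → Config*)
                  (f-tropical : IsTropicalT B ρ f) (g-tropical : IsTropicalT B* B*.ρ g) where
    open Time
    open Int using (+_)

    FoldedAt : ℤ → Set
    FoldedAt t = ∀ c → Even (t Int.+ toℤ c) → Folded c (f t) (g t)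

    initially-folded : ∀ b → FoldedAt (toℤ b)
    initially-folded b c ev = subst (λ c → Folded c (f (toℤ b)) (g (toℤ b))) (sym (even-colour b c ev))
      (folded-resp (λ v e → subst (λ b → ρ v ≡ f (toℤ b) v) e (sym (proj₁ f-tropical v)))
                   (λ w e → subst (λ b → B*.ρ w ≡ g (toℤ b) w) e (sym (proj₁ g-tropical w)))
                   (initial-folded b))

    -- The recurrence at time t, where (f t, g t) is folded at colour ¬c,
    -- carries foldedness at colour c from time κ to time τ ({τ, κ} = {t ± 1}):
    -- the right-hand sides are folded at c, and foldedness is linear.
    propagate : ∀ t τ κ c → Odd (t Int.+ toℤ c) → FoldedAt t →
      (∀ v → ε v ≡ c → f τ v + f κ v ≡ tropical-rhs B (f t) v) →
      (∀ w → B*.ε w ≡ c → g τ w + g κ w ≡ tropical-rhs B* (g t) w) →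
      Folded c (f κ) (g κ) → Folded c (f τ) (g τ)
    propagate t τ κ c odd now f-rec g-rec earlier =
      folded-cancel (folded-resp (λ v e → sym (f-rec v e)) (λ w e → sym (g-rec w e)) rhs) earlier
      where
      rhs : Folded c (tropical-rhs B (f t)) (tropical-rhs B* (g t))
      rhs = subst (λ c → Folded c _ _) (not-involutive c) (rhs-folded (now (not c) (odd⇒even-not t c odd)))

    f-recurrence : ∀ t c → Odd (t Int.+ toℤ c) → ∀ v → ε v ≡ c →
      f (t Int.+ + 1) v + f (t Int.- + 1) v ≡ tropical-rhs B (f t) v
    f-recurrence t c odd v e = proj₂ f-tropical t v (subst (λ b → Odd (t Int.+ toℤ b)) (sym e) odd)

    g-recurrence : ∀ t c → Odd (t Int.+ toℤ c) → ∀ w → B*.ε w ≡ c →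
      g (t Int.+ + 1) w + g (t Int.- + 1) w ≡ tropical-rhs B* (g t) w
    g-recurrence t c odd w e = proj₂ g-tropical t w (subst (λ b → Odd (t Int.+ toℤ b)) (sym e) odd)

    forward : ∀ t → FoldedAt (t Int.- + 1) → FoldedAt t → FoldedAt (t Int.+ + 1)
    forward t before now c ev =
      propagate t _ _ c odd now (f-recurrence t c odd) (g-recurrence t c odd)
        (before c (subst Even (sym (pred-shift t (toℤ c))) (odd⇒even-pred odd)))
      where
      odd : Odd (t Int.+ toℤ c)
      odd = even-suc⇒odd (subst Even (suc-shift t (toℤ c)) ev)

    backward : ∀ t → FoldedAt (t Int.+ + 1) → FoldedAt t → FoldedAt (t Int.- + 1)
    backward t after now c ev =
      propagate t _ _ c odd now
        (λ v e → trans (+-comm _ _) (f-recurrence t c odd v e))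
        (λ w e → trans (+-comm _ _) (g-recurrence t c odd w e))
        (after c (subst Even (sym (suc-shift t (toℤ c))) (odd⇒even-suc odd)))
      where
      odd : Odd (t Int.+ toℤ c)
      odd = even-pred⇒odd (subst Even (pred-shift t (toℤ c)) ev)

    always-folded : ∀ t → FoldedAt t
    always-folded = ℤ-induction₂ FoldedAt (initially-folded false) (initially-folded true) forward backward

    periodicity : ∀ N → Periodic B N f ⇔ Periodic B* N g
    periodicity N = mk⇔ to from
      where
      later : ∀ t c → Even (t Int.+ toℤ c) → Folded c (f (t Int.+ + (2 ℕ.* N))) (g (t Int.+ + (2 ℕ.* N)))
      later t c ev = always-folded _ c (even-shift t (toℤ c) N ev)

      to : Periodic B N f → Periodic B* N g
      to periodic t w ev = folded-agree* (later t c ev) (always-folded t c ev)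
        (λ v e → periodic t v (subst (λ b → Even (t Int.+ toℤ b)) (sym e) ev)) w refl
        where c = B*.ε w

      from : Periodic B* N g → Periodic B N f
      from periodic t v ev = folded-agree (later t c ev) (always-folded t c ev)
        (λ w e → periodic t w (subst (λ b → Even (t Int.+ toℤ b)) (sym e) ev)) v refl
        where c = ε v

-- Corollary 9.4, with the unused hypotheses (recurrence, N ≥ 1) ignored.
corollary9p4 : (R : RealField) (s : RealField.Carrier R) → IsSqrt2 R s →
    {k m : ℕ} (B : SLB R k m) (B* : SLB R m k) → IsDual s B B* →
    Recurrent B → Recurrent B* →
    (N : ℕ) → 1 ≤ N →
    (f : ℤ → SV k m → RealField.Carrier R) (g : ℤ → SV m k → RealField.Carrier R) →
    IsTropicalT B (SLB.ρ B) f → IsTropicalT B* (SLB.ρ B*) g →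
    (Periodic B N f ⇔ Periodic B* N g)
corollary9p4 R s s-is-√2 B B* duality _ _ N _ f g f-tropical g-tropical = periodicity N
  where open Folding R s s-is-√2 B B* duality
        open Dynamics f g f-tropical g-tropical
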